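{- Let $n\in\mathbb{N}$ and $\sigma=(\sigma_1,\dots,\sigma_n)\in\Sigma_n$ with $\sigma_n>1$, and let $\sigma'=(\sigma_1,\dots,\sigma_{n-1},\sigma_n-1,1)\in\Sigma_{n+1}$. Then $$\mathcal{E}^*(\sigma')=\mathcal{E}^*(\sigma)+\frac{(-1)^n}{q_n^*(\sigma)\bigl(q_n^*(\sigma)-q_{n-1}^*(\sigma)\bigr)}.$$
   Context: For $m\in\mathbb{N}$, $\Sigma_m=\mathbb{N}^m\times\{\infty\}^{\mathbb{N}\setminus\{1,\dots,m\}}$, and a finite tuple $(\sigma_1,\dots,\sigma_m)$ denotes $(\sigma_1,\dots,\sigma_m,\infty,\infty,\dots)\in\Sigma_m$. For such a sequence $\sigma$, let $\varphi_0(\sigma)=0$, $\varphi_k(\sigma)=[0;\sigma_1,\dots,\sigma_k,\infty,\infty,\dots]$ (a finite continued fraction, with conventions $1/\infty=0$, $\infty+c=\infty$, so $\varphi_k(\sigma)=\varphi_m(\sigma)$ for $k\ge m$), and $\varphi(\sigma)=\lim_k\varphi_k(\sigma)$. Write $\varphi_k(\sigma)=p_k^*(\sigma)/q_k^*(\sigma)$ in lowest terms with $q_k^*(\sigma)\ge1$, with $p_0^*(\sigma)=0$, $q_0^*(\sigma)=1$. Define $\mathcal{E}^*(\sigma)=\sum_{k\ge0}(\varphi(\sigma)-\varphi_k(\sigma))$. -}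

module Defs where

open import Data.Nat as ℕ using (ℕ)
open import Data.Integer as ℤ using (ℤ)
open import Data.Rational as ℚ using (ℚ; 0ℚ; _+_; _-_; 1/_; ≢-nonZero)
open import Data.Rational.Properties using (_≟_)
open import Data.List using (List; []; _∷_; take; map; upTo; foldr; length)
open import Relation.Nullary using (yes; no)

-- Total reciprocal on ℚ (value 0 at 0).  In every use below the argument is
-- nonzero, so this is the ordinary reciprocal.
recip : ℚ → ℚ
recip p with p ≟ 0ℚ
... | yes _  = 0ℚ
... | no p≢0 = 1/_ p {{≢-nonZero p≢0}}

-- Finite continued fraction [0; a₁, …, aₖ] = 1/(a₁ + [0; a₂, …, aₖ]), [0;] = 0.
cf : List ℕ → ℚ
cf []       = 0ℚ
cf (a ∷ as) = recip ((ℤ.+ a ℚ./ 1) + cf as)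

-- A sequence σ ∈ Σ_m is represented by the list [σ₁, …, σ_m] (entries ≥ 1).
-- φ_k(σ) = [0; σ₁, …, σ_k]  (= φ_m(σ) for k ≥ m, since take saturates)
φ : ℕ → List ℕ → ℚ
φ k σ = cf (take k σ)

-- φ(σ) = lim_k φ_k(σ) = φ_m(σ) for σ ∈ Σ_m
φ∞ : List ℕ → ℚ
φ∞ σ = cf σ

-- q*_k(σ): denominator of φ_k(σ) in lowest terms (ℚ is stored reduced, denominator ≥ 1)
q* : ℕ → List ℕ → ℕ
q* k σ = ℚ.denominatorℕ (φ k σ)

sumℚ : List ℚ → ℚ
sumℚ = foldr _+_ 0ℚ

-- E*(σ) = Σ_{k ≥ 0} (φ(σ) − φ_k(σ)); terms with k ≥ m vanish, so sum over k = 0 … m−1.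
E* : List ℕ → ℚ
E* σ = sumℚ (map (λ k → φ∞ σ - φ k σ) (upTo (length σ)))

{-# OPTIONS --safe #-}
-- Replacing the last entry s of σ by s − 1, 1 does not change the value φ(σ), and the
-- first n truncations of σ and σ′ agree, so E*(σ′) − E*(σ) is the single new term
-- φ(σ) − [0; σ₁, …, σ_{n−1}, s − 1].  Writing [0; τ, t] as the image of the tail 1/t
-- under the product of the matrices [[0,1],[1,a]], a ∈ τ, both fractions come out in
-- lowest terms; linearity gives the denominators q_n and q_n − q_{n−1}, and the
-- determinant (−1)^(n−1) of the product gives the numerator (−1)^n of the difference.
module Submission where

open import Defs
open import Data.Nat as ℕ using (ℕ; _≤_; _<_; zero; suc; z≤n; s≤s)
import Data.Nat.Properties as ℕP
open import Algebra.Properties.CommutativeSemigroup ℕP.+-commutativeSemigroup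
  using () renaming (interchange to +-interchange)
open import Data.Nat.Coprimality as Coprimality using (Coprime)
open import Data.Nat.Divisibility using (∣m+n∣m⇒∣n; ∣n⇒∣m*n)
open import Data.Integer as ℤ using (ℤ; +_; -1ℤ)
import Data.Integer.Properties as ℤP
import Data.Integer.Tactic.RingSolver as ℤ-Solver
open import Data.Rational as ℚ using (ℚ; _+_; _*_; _-_; -_; _/_; 0ℚ; 1ℚ; 1/_)
import Data.Rational.Properties as ℚP
open import Data.Rational.Unnormalised as ℚᵘ using (mkℚᵘ; *≡*)
import Data.Rational.Unnormalised.Properties as ℚᵘP
open import Data.List using (List; []; _∷_; _++_; _∷ʳ_; length; take; map; upTo)
open import Data.List.Properties using (map-++; map-cong-local; upTo-∷ʳ; length-++; ++-identityʳ)
open import Data.List.Relation.Unary.All as All using (All; []; _∷_)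
open import Data.List.Relation.Unary.All.Properties using (all-upTo)
open import Data.Empty using (⊥-elim)
open import Data.Product using (_,_)
open import Relation.Nullary using (yes; no)
open import Relation.Binary.PropositionalEquality
open ≡-Reasoning

fromℚᵘ-homo-+ : ∀ p q → ℚ.fromℚᵘ (p ℚᵘ.+ q) ≡ ℚ.fromℚᵘ p + ℚ.fromℚᵘ q
fromℚᵘ-homo-+ p q = ℚP.toℚᵘ-injective (ℚᵘP.≃-trans (ℚP.toℚᵘ-fromℚᵘ (p ℚᵘ.+ q))
  (ℚᵘP.≃-sym (ℚᵘP.≃-trans (ℚP.toℚᵘ-homo-+ (ℚ.fromℚᵘ p) (ℚ.fromℚᵘ q))
                          (ℚᵘP.+-cong (ℚP.toℚᵘ-fromℚᵘ p) (ℚP.toℚᵘ-fromℚᵘ q)))))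

fromℚᵘ-homo-* : ∀ p q → ℚ.fromℚᵘ (p ℚᵘ.* q) ≡ ℚ.fromℚᵘ p * ℚ.fromℚᵘ q
fromℚᵘ-homo-* p q = ℚP.toℚᵘ-injective (ℚᵘP.≃-trans (ℚP.toℚᵘ-fromℚᵘ (p ℚᵘ.* q))
  (ℚᵘP.≃-sym (ℚᵘP.≃-trans (ℚP.toℚᵘ-homo-* (ℚ.fromℚᵘ p) (ℚ.fromℚᵘ q))
                          (ℚᵘP.*-cong (ℚP.toℚᵘ-fromℚᵘ p) (ℚP.toℚᵘ-fromℚᵘ q)))))

fromℚᵘ-homo‿- : ∀ p → ℚ.fromℚᵘ (ℚᵘ.- p) ≡ - ℚ.fromℚᵘ p
fromℚᵘ-homo‿- p = ℚP.toℚᵘ-injective (ℚᵘP.≃-trans (ℚP.toℚᵘ-fromℚᵘ (ℚᵘ.- p))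
  (ℚᵘP.≃-sym (ℚᵘP.≃-trans (ℚP.toℚᵘ-homo‿- (ℚ.fromℚᵘ p)) (ℚᵘP.-‿cong (ℚP.toℚᵘ-fromℚᵘ p)))))

-- a / suc b unfolds to fromℚᵘ (mkℚᵘ a b), so these are the homomorphisms read backwards.

/-+-/ : ∀ a b c d → a / suc b + c / suc d ≡ (a ℤ.* + suc d ℤ.+ c ℤ.* + suc b) / (suc b ℕ.* suc d)
/-+-/ a b c d = sym (fromℚᵘ-homo-+ (mkℚᵘ a b) (mkℚᵘ c d))

/-*-/ : ∀ a b c d → (a / suc b) * (c / suc d) ≡ (a ℤ.* c) / (suc b ℕ.* suc d)
/-*-/ a b c d = sym (fromℚᵘ-homo-* (mkℚᵘ a b) (mkℚᵘ c d))

-‿/ : ∀ a b → - (a / suc b) ≡ (ℤ.- a) / suc b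
-‿/ a b = sym (fromℚᵘ-homo‿- (mkℚᵘ a b))

/-cross : ∀ {a c} b d .{{_ : ℕ.NonZero b}} .{{_ : ℕ.NonZero d}} →
          a ℤ.* + d ≡ c ℤ.* + b → a / b ≡ c / d
/-cross {a} {c} (suc b) (suc d) eq = ℚP.fromℚᵘ-cong {mkℚᵘ a b} {mkℚᵘ c d} (*≡* eq)

*≡1⇒recip≡ : ∀ x y → x * y ≡ 1ℚ → recip x ≡ y
*≡1⇒recip≡ x y xy≡1 with x ℚP.≟ 0ℚ
... | yes x≡0 = ⊥-elim (ℚP.1≢0 (begin
  1ℚ       ≡⟨ xy≡1 ⟨
  x * y    ≡⟨ cong (_* y) x≡0 ⟩
  0ℚ * y   ≡⟨ ℚP.*-zeroˡ y ⟩
  0ℚ       ∎))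
... | no x≢0 = begin
  1/ x               ≡⟨ ℚP.*-identityʳ (1/ x) ⟨
  1/ x * 1ℚ          ≡⟨ cong (1/ x *_) xy≡1 ⟨
  1/ x * (x * y)     ≡⟨ ℚP.*-assoc (1/ x) x y ⟨
  (1/ x * x) * y     ≡⟨ cong (_* y) (ℚP.*-inverseˡ x) ⟩
  1ℚ * y             ≡⟨ ℚP.*-identityˡ y ⟩
  y                  ∎
  where instance _ = ℚ.≢-nonZero x≢0

recip-/ : ∀ m n → recip (+ suc m / suc n) ≡ + suc n / suc m
recip-/ m n = *≡1⇒recip≡ (+ suc m / suc n) (+ suc n / suc m) (begin
  (+ suc m / suc n) * (+ suc n / suc m)    ≡⟨ /-*-/ (+ suc m) n (+ suc n) m ⟩
  (+ suc m ℤ.* + suc n) / (suc n ℕ.* suc m) ≡⟨ /-cross {+ suc m ℤ.* + suc n} {+ 1} (suc n ℕ.* suc m) 1 eq ⟩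
  + 1 / 1                                  ∎)
  where
  eq : (+ suc m ℤ.* + suc n) ℤ.* + 1 ≡ + 1 ℤ.* + (suc n ℕ.* suc m)
  eq = begin
    (+ suc m ℤ.* + suc n) ℤ.* + 1 ≡⟨ ℤP.*-identityʳ _ ⟩
    + suc m ℤ.* + suc n           ≡⟨ ℤP.*-comm (+ suc m) (+ suc n) ⟩
    + suc n ℤ.* + suc m           ≡⟨ ℤP.pos-* (suc n) (suc m) ⟨
    + (suc n ℕ.* suc m)           ≡⟨ ℤP.*-identityˡ _ ⟨
    + 1 ℤ.* + (suc n ℕ.* suc m)   ∎

/1-*-recip : ∀ c k → (c / 1) * recip (+ suc k / 1) ≡ c / suc k
/1-*-recip c k = begin
  (c / 1) * recip (+ suc k / 1)   ≡⟨ cong ((c / 1) *_) (recip-/ k 0) ⟩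
  (c / 1) * (+ 1 / suc k)         ≡⟨ /-*-/ c 0 (+ 1) k ⟩
  (c ℤ.* + 1) / (1 ℕ.* suc k)     ≡⟨ cong₂ (λ a b → a / suc b) (ℤP.*-identityʳ c) (ℕP.+-identityʳ k) ⟩
  c / suc k                       ∎

pos-*-+ : ∀ a d n → + (a ℕ.* d ℕ.+ n) ≡ + a ℤ.* + d ℤ.+ + n
pos-*-+ a d n = trans (ℤP.pos-+ (a ℕ.* d) n) (cong (ℤ._+ + n) (ℤP.pos-* a d))

data LowestTerms : ℚ → ℕ → ℕ → Set where
  lowest : ∀ {p d} → Coprime p (suc d) → LowestTerms (+ p / suc d) p (suc d)

denominator-lowest : ∀ {x p q} → LowestTerms x p q → ℚ.denominatorℕ x ≡ q
denominator-lowest (lowest c) = cong ℚ.denominatorℕ (ℚP.normalize-coprime c)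

lowest-unique : ∀ {x y p q q′} → LowestTerms x p q → LowestTerms y p q′ → q ≡ q′ → x ≡ y
lowest-unique (lowest _) (lowest _) refl = refl

lowest-0 : LowestTerms 0ℚ 0 1
lowest-0 = lowest (Coprimality.sym (Coprimality.1-coprimeTo 0))

coprime-*+ : ∀ a {p q} → Coprime p q → Coprime q (a ℕ.* q ℕ.+ p)
coprime-*+ a p⊥q (i∣q , i∣aq+p) = p⊥q (∣m+n∣m⇒∣n i∣aq+p (∣n⇒∣m*n a i∣q) , i∣q)

lowest-step : ∀ a {x p q} → LowestTerms x p q →
              LowestTerms (recip (+ suc a / 1 + x)) q (suc a ℕ.* q ℕ.+ p)
lowest-step a {p = p} (lowest {d = d} p⊥q) =
  subst (λ y → LowestTerms y (suc d) (suc a ℕ.* suc d ℕ.+ p)) (sym value) (lowest (coprime-*+ (suc a) p⊥q))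
  where
  numerator : + suc a ℤ.* + suc d ℤ.+ + p ℤ.* + 1 ≡ + (suc a ℕ.* suc d ℕ.+ p)
  numerator = trans (cong (λ z → + suc a ℤ.* + suc d ℤ.+ z) (ℤP.*-identityʳ (+ p)))
                    (sym (pos-*-+ (suc a) (suc d) p))
  value : recip (+ suc a / 1 + + p / suc d) ≡ + suc d / (suc a ℕ.* suc d ℕ.+ p)
  value = begin
    recip (+ suc a / 1 + + p / suc d)
      ≡⟨ cong recip (/-+-/ (+ suc a) 0 (+ p) d) ⟩
    recip ((+ suc a ℤ.* + suc d ℤ.+ + p ℤ.* + 1) / (1 ℕ.* suc d))
      ≡⟨ cong recip (cong₂ (λ n m → n / suc m) numerator (ℕP.+-identityʳ d)) ⟩
    recip (+ (suc a ℕ.* suc d ℕ.+ p) / suc d)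
      ≡⟨ recip-/ (d ℕ.+ a ℕ.* suc d ℕ.+ p) d ⟩
    + suc d / (suc a ℕ.* suc d ℕ.+ p) ∎

det : ℕ → ℕ → ℕ → ℕ → ℤ
det p q p′ q′ = + p ℤ.* + q′ ℤ.- + p′ ℤ.* + q

lowest-difference : ∀ {x y p q p′ q′} → LowestTerms x p q → LowestTerms y p′ q′ →
                    x - y ≡ (det p q p′ q′ / 1) * recip ((+ q ℤ.* + q′) / 1)
lowest-difference (lowest {p} {d} _) (lowest {p′} {d′} _) = begin
  + p / suc d - + p′ / suc d′
    ≡⟨ cong (λ z → + p / suc d + z) (-‿/ (+ p′) d′) ⟩
  + p / suc d + (ℤ.- + p′) / suc d′
    ≡⟨ /-+-/ (+ p) d (ℤ.- + p′) d′ ⟩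
  (+ p ℤ.* + suc d′ ℤ.+ (ℤ.- + p′) ℤ.* + suc d) / (suc d ℕ.* suc d′)
    ≡⟨ cong (λ z → (+ p ℤ.* + suc d′ ℤ.+ z) / (suc d ℕ.* suc d′)) (ℤP.neg-distribˡ-* (+ p′) (+ suc d)) ⟨
  det p (suc d) p′ (suc d′) / (suc d ℕ.* suc d′)
    ≡⟨ /1-*-recip (det p (suc d) p′ (suc d′)) (d′ ℕ.+ d ℕ.* suc d′) ⟨
  (det p (suc d) p′ (suc d′) / 1) * recip (+ (suc d ℕ.* suc d′) / 1)
    ≡⟨ cong (λ z → (det p (suc d) p′ (suc d′) / 1) * recip (z / 1)) (ℤP.pos-* (suc d) (suc d′)) ⟩
  (det p (suc d) p′ (suc d′) / 1) * recip ((+ suc d ℤ.* + suc d′) / 1) ∎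

mutual
  numer : List ℕ → ℕ → ℕ → ℕ
  numer []      p q = p
  numer (_ ∷ L) p q = denom L p q

  denom : List ℕ → ℕ → ℕ → ℕ
  denom []      p q = q
  denom (a ∷ L) p q = a ℕ.* denom L p q ℕ.+ numer L p q

cf-++-lowest : ∀ L {r p q} → All (1 ≤_) L → LowestTerms (cf r) p q →
               LowestTerms (cf (L ++ r)) (numer L p q) (denom L p q)
cf-++-lowest []          []              r≡p/q = r≡p/q
cf-++-lowest (suc a ∷ L) (s≤s z≤n ∷ 1≤L) r≡p/q = lowest-step a (cf-++-lowest L 1≤L r≡p/q)

cf-singleton-lowest : ∀ a → LowestTerms (cf (suc a ∷ [])) 1 (suc a)
cf-singleton-lowest a =
  subst (LowestTerms (cf (suc a ∷ [])) 1) (trans (ℕP.+-identityʳ _) (ℕP.*-identityʳ (suc a)))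
        (lowest-step a lowest-0)

cf-++-cong : ∀ L {r r′} → cf r ≡ cf r′ → cf (L ++ r) ≡ cf (L ++ r′)
cf-++-cong []      r≡r′ = r≡r′
cf-++-cong (a ∷ L) r≡r′ = cong (λ z → recip (+ a / 1 + z)) (cf-++-cong L r≡r′)

cf-[a,1]≡cf-[1+a] : ∀ a → cf (suc a ∷ 1 ∷ []) ≡ cf (suc (suc a) ∷ [])
cf-[a,1]≡cf-[1+a] a = lowest-unique (lowest-step a (cf-singleton-lowest 0)) (cf-singleton-lowest (suc a))
  (trans (cong (ℕ._+ 1) (ℕP.*-identityʳ (suc a))) (ℕP.+-comm (suc a) 1))

mutual
  numer-+ : ∀ L p q p′ q′ → numer L (p ℕ.+ p′) (q ℕ.+ q′) ≡ numer L p q ℕ.+ numer L p′ q′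
  numer-+ []      p q p′ q′ = refl
  numer-+ (_ ∷ L) p q p′ q′ = denom-+ L p q p′ q′

  denom-+ : ∀ L p q p′ q′ → denom L (p ℕ.+ p′) (q ℕ.+ q′) ≡ denom L p q ℕ.+ denom L p′ q′
  denom-+ []      p q p′ q′ = refl
  denom-+ (a ∷ L) p q p′ q′ = begin
    a ℕ.* denom L (p ℕ.+ p′) (q ℕ.+ q′) ℕ.+ numer L (p ℕ.+ p′) (q ℕ.+ q′)
      ≡⟨ cong₂ (λ d n → a ℕ.* d ℕ.+ n) (denom-+ L p q p′ q′) (numer-+ L p q p′ q′) ⟩
    a ℕ.* (denom L p q ℕ.+ denom L p′ q′) ℕ.+ (numer L p q ℕ.+ numer L p′ q′)
      ≡⟨ cong (ℕ._+ (numer L p q ℕ.+ numer L p′ q′)) (ℕP.*-distribˡ-+ a (denom L p q) (denom L p′ q′)) ⟩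
    (a ℕ.* denom L p q ℕ.+ a ℕ.* denom L p′ q′) ℕ.+ (numer L p q ℕ.+ numer L p′ q′)
      ≡⟨ +-interchange (a ℕ.* denom L p q) (a ℕ.* denom L p′ q′) (numer L p q) (numer L p′ q′) ⟩
    (a ℕ.* denom L p q ℕ.+ numer L p q) ℕ.+ (a ℕ.* denom L p′ q′ ℕ.+ numer L p′ q′) ∎

-- The matrix [[0,1],[1,a]] has determinant −1.
det-shift : ∀ a n d n′ d′ → det d (a ℕ.* d ℕ.+ n) d′ (a ℕ.* d′ ℕ.+ n′) ≡ ℤ.- det n d n′ d′
det-shift a n d n′ d′ = begin
  + d ℤ.* + (a ℕ.* d′ ℕ.+ n′) ℤ.- + d′ ℤ.* + (a ℕ.* d ℕ.+ n)
    ≡⟨ cong₂ (λ u v → + d ℤ.* u ℤ.- + d′ ℤ.* v) (pos-*-+ a d′ n′) (pos-*-+ a d n) ⟩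
  + d ℤ.* (+ a ℤ.* + d′ ℤ.+ + n′) ℤ.- + d′ ℤ.* (+ a ℤ.* + d ℤ.+ + n)
    ≡⟨ cross-terms-cancel (+ a) (+ n) (+ d) (+ n′) (+ d′) ⟩
  ℤ.- (+ n ℤ.* + d′ ℤ.- + n′ ℤ.* + d) ∎
  where
  cross-terms-cancel : ∀ A N D N′ D′ → D ℤ.* (A ℤ.* D′ ℤ.+ N′) ℤ.- D′ ℤ.* (A ℤ.* D ℤ.+ N) ≡ ℤ.- (N ℤ.* D′ ℤ.- N′ ℤ.* D)
  cross-terms-cancel = ℤ-Solver.solve-∀

det-numer-denom : ∀ L p q p′ q′ →
  det (numer L p q) (denom L p q) (numer L p′ q′) (denom L p′ q′) ≡ -1ℤ ℤ.^ length L ℤ.* det p q p′ q′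
det-numer-denom []      p q p′ q′ = sym (ℤP.*-identityˡ (det p q p′ q′))
det-numer-denom (a ∷ L) p q p′ q′ = begin
  det (denom L p q) (a ℕ.* denom L p q ℕ.+ numer L p q) (denom L p′ q′) (a ℕ.* denom L p′ q′ ℕ.+ numer L p′ q′)
    ≡⟨ det-shift a (numer L p q) (denom L p q) (numer L p′ q′) (denom L p′ q′) ⟩
  ℤ.- det (numer L p q) (denom L p q) (numer L p′ q′) (denom L p′ q′)
    ≡⟨ cong ℤ.-_ (det-numer-denom L p q p′ q′) ⟩
  ℤ.- (-1ℤ ℤ.^ length L ℤ.* det p q p′ q′)
    ≡⟨ ℤP.-1*i≡-i _ ⟨
  -1ℤ ℤ.* (-1ℤ ℤ.^ length L ℤ.* det p q p′ q′)
    ≡⟨ ℤP.*-assoc -1ℤ (-1ℤ ℤ.^ length L) (det p q p′ q′) ⟨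
  -1ℤ ℤ.^ suc (length L) ℤ.* det p q p′ q′ ∎

cf-∷ʳ-difference : ∀ τ a → All (1 ≤_) τ →
  cf (τ ∷ʳ suc (suc a)) - cf (τ ∷ʳ suc a)
    ≡ ((-1ℤ ℤ.^ suc (length τ)) / 1)
      * recip ((+ denom τ 1 (suc (suc a)) ℤ.* (+ denom τ 1 (suc (suc a)) ℤ.- + denom τ 0 1)) / 1)
cf-∷ʳ-difference τ a 1≤τ = begin
  cf (τ ∷ʳ suc (suc a)) - cf (τ ∷ʳ suc a)
    ≡⟨ lowest-difference (cf-++-lowest τ 1≤τ (cf-singleton-lowest (suc a)))
                         (cf-++-lowest τ 1≤τ (cf-singleton-lowest a)) ⟩
  (det (numer τ 1 (suc (suc a))) Q (numer τ 1 (suc a)) Q′ / 1) * recip ((+ Q ℤ.* + Q′) / 1)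
    ≡⟨ cong₂ (λ c r → (c / 1) * recip ((+ Q ℤ.* r) / 1)) determinant Q′≡Q-Q₀ ⟩
  ((-1ℤ ℤ.^ suc (length τ)) / 1) * recip ((+ Q ℤ.* (+ Q ℤ.- + Q₀)) / 1) ∎
  where
  Q  = denom τ 1 (suc (suc a))
  Q′ = denom τ 1 (suc a)
  Q₀ = denom τ 0 1
  determinant : det (numer τ 1 (suc (suc a))) Q (numer τ 1 (suc a)) Q′ ≡ -1ℤ ℤ.^ suc (length τ)
  determinant = begin
    det (numer τ 1 (suc (suc a))) Q (numer τ 1 (suc a)) Q′
      ≡⟨ det-numer-denom τ 1 (suc (suc a)) 1 (suc a) ⟩
    -1ℤ ℤ.^ length τ ℤ.* det 1 (suc (suc a)) 1 (suc a)
      ≡⟨ cong (-1ℤ ℤ.^ length τ ℤ.*_) (det-1-suc (+ suc a)) ⟩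
    -1ℤ ℤ.^ length τ ℤ.* -1ℤ
      ≡⟨ ℤP.*-comm (-1ℤ ℤ.^ length τ) -1ℤ ⟩
    -1ℤ ℤ.^ suc (length τ) ∎
    where
    det-1-suc : ∀ k → ℤ.1ℤ ℤ.* k ℤ.- ℤ.1ℤ ℤ.* (ℤ.1ℤ ℤ.+ k) ≡ -1ℤ
    det-1-suc = ℤ-Solver.solve-∀
  Q′≡Q-Q₀ : + Q′ ≡ + Q ℤ.- + Q₀
  Q′≡Q-Q₀ = begin
    + Q′                        ≡⟨ cancel (+ Q₀) (+ Q′) ⟨
    (+ Q₀ ℤ.+ + Q′) ℤ.- + Q₀    ≡⟨ cong (ℤ._- + Q₀) (ℤP.pos-+ Q₀ Q′) ⟨
    + (Q₀ ℕ.+ Q′) ℤ.- + Q₀      ≡⟨ cong (λ n → + n ℤ.- + Q₀) (denom-+ τ 0 1 1 (suc a)) ⟨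
    + Q ℤ.- + Q₀                ∎
    where
    cancel : ∀ m n → (m ℤ.+ n) ℤ.- m ≡ n
    cancel = ℤ-Solver.solve-∀

take-++ˡ : ∀ {A : Set} k (xs ys : List A) → k ≤ length xs → take k (xs ++ ys) ≡ take k xs
take-++ˡ zero    xs       ys _         = refl
take-++ˡ (suc k) (x ∷ xs) ys (s≤s k≤n) = cong (x ∷_) (take-++ˡ k xs ys k≤n)

take-length-++ : ∀ {A : Set} (xs ys : List A) → take (length xs) (xs ++ ys) ≡ xs
take-length-++ []       ys = refl
take-length-++ (x ∷ xs) ys = cong (x ∷_) (take-length-++ xs ys)

take-suc-length-++ : ∀ {A : Set} (xs : List A) y ys → take (suc (length xs)) (xs ++ y ∷ ys) ≡ xs ∷ʳ y
take-suc-length-++ []       y ys = refl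
take-suc-length-++ (x ∷ xs) y ys = cong (x ∷_) (take-suc-length-++ xs y ys)

q*-length : ∀ τ ys → All (1 ≤_) τ → q* (length τ) (τ ++ ys) ≡ denom τ 0 1
q*-length τ ys 1≤τ = begin
  ℚ.denominatorℕ (cf (take (length τ) (τ ++ ys)))
    ≡⟨ cong (λ xs → ℚ.denominatorℕ (cf xs)) (trans (take-length-++ τ ys) (sym (++-identityʳ τ))) ⟩
  ℚ.denominatorℕ (cf (τ ++ []))
    ≡⟨ denominator-lowest (cf-++-lowest τ 1≤τ lowest-0) ⟩
  denom τ 0 1 ∎

q*-suc-length : ∀ τ a → All (1 ≤_) τ → q* (suc (length τ)) (τ ∷ʳ suc a) ≡ denom τ 1 (suc a)
q*-suc-length τ a 1≤τ = begin
  ℚ.denominatorℕ (cf (take (suc (length τ)) (τ ∷ʳ suc a)))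
    ≡⟨ cong (λ xs → ℚ.denominatorℕ (cf xs)) (take-suc-length-++ τ (suc a) []) ⟩
  ℚ.denominatorℕ (cf (τ ∷ʳ suc a))
    ≡⟨ denominator-lowest (cf-++-lowest τ 1≤τ (cf-singleton-lowest a)) ⟩
  denom τ 1 (suc a) ∎

sumℚ-∷ʳ : ∀ xs x → sumℚ (xs ∷ʳ x) ≡ sumℚ xs + x
sumℚ-∷ʳ []       x = trans (ℚP.+-identityʳ x) (sym (ℚP.+-identityˡ x))
sumℚ-∷ʳ (y ∷ xs) x = trans (cong (λ s → y + s) (sumℚ-∷ʳ xs x)) (sym (ℚP.+-assoc y (sumℚ xs) x))

E*-extend : ∀ {m} σ σ′ → length σ ≡ m → length σ′ ≡ suc m → φ∞ σ′ ≡ φ∞ σ →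
            (∀ {k} → k < m → φ k σ′ ≡ φ k σ) → E* σ′ ≡ E* σ + (φ∞ σ - φ m σ′)
E*-extend {m} σ σ′ |σ|≡m |σ′|≡1+m φ∞σ′≡φ∞σ φₖσ′≡φₖσ = begin
  sumℚ (map e′ (upTo (length σ′)))   ≡⟨ cong (λ n → sumℚ (map e′ (upTo n))) |σ′|≡1+m ⟩
  sumℚ (map e′ (upTo (suc m)))       ≡⟨ cong (λ ks → sumℚ (map e′ ks)) (upTo-∷ʳ m) ⟨
  sumℚ (map e′ (upTo m ∷ʳ m))        ≡⟨ cong sumℚ (map-++ e′ (upTo m) (m ∷ [])) ⟩
  sumℚ (map e′ (upTo m) ∷ʳ e′ m)     ≡⟨ sumℚ-∷ʳ (map e′ (upTo m)) (e′ m) ⟩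
  sumℚ (map e′ (upTo m)) + e′ m      ≡⟨ cong₂ _+_ (cong sumℚ (map-cong-local (All.map e′≡e (all-upTo m))))
                                                  (cong (_- φ m σ′) φ∞σ′≡φ∞σ) ⟩
  sumℚ (map e (upTo m)) + (φ∞ σ - φ m σ′)
    ≡⟨ cong (λ n → sumℚ (map e (upTo n)) + (φ∞ σ - φ m σ′)) |σ|≡m ⟨
  E* σ + (φ∞ σ - φ m σ′) ∎
  where
  e e′ : ℕ → ℚ
  e  k = φ∞ σ - φ k σ
  e′ k = φ∞ σ′ - φ k σ′
  e′≡e : ∀ {k} → k < m → e′ k ≡ e k
  e′≡e k<m = cong₂ _-_ φ∞σ′≡φ∞σ (φₖσ′≡φₖσ k<m)

E*-split-last : ∀ τ {x y z} → cf (x ∷ y ∷ []) ≡ cf (z ∷ []) →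
                E* (τ ++ x ∷ y ∷ []) ≡ E* (τ ∷ʳ z) + (cf (τ ∷ʳ z) - cf (τ ∷ʳ x))
E*-split-last τ {x} {y} {z} xy≡z = begin
  E* (τ ++ x ∷ y ∷ [])
    ≡⟨ E*-extend (τ ∷ʳ z) (τ ++ x ∷ y ∷ [])
                 (trans (length-++ τ) (ℕP.+-comm (length τ) 1))
                 (trans (length-++ τ) (ℕP.+-comm (length τ) 2))
                 (cf-++-cong τ xy≡z) same-prefix ⟩
  E* (τ ∷ʳ z) + (cf (τ ∷ʳ z) - cf (take (suc (length τ)) (τ ++ x ∷ y ∷ [])))
    ≡⟨ cong (λ xs → E* (τ ∷ʳ z) + (cf (τ ∷ʳ z) - cf xs)) (take-suc-length-++ τ x (y ∷ [])) ⟩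
  E* (τ ∷ʳ z) + (cf (τ ∷ʳ z) - cf (τ ∷ʳ x)) ∎
  where
  same-prefix : ∀ {k} → k < suc (length τ) → φ k (τ ++ x ∷ y ∷ []) ≡ φ k (τ ∷ʳ z)
  same-prefix {k} (s≤s k≤|τ|) = cong cf (trans (take-++ˡ k τ _ k≤|τ|) (sym (take-++ˡ k τ _ k≤|τ|)))

lemma3p6 : (τ : List ℕ) (s : ℕ) → All (1 ≤_) τ → 1 < s →
    let σ  = τ ++ (s ∷ [])
        σ' = τ ++ (s ℕ.∸ 1 ∷ 1 ∷ [])
        n  = ℕ.suc (length τ)
        qn = ℤ.+ (q* n σ)
        qn₁ = ℤ.+ (q* (n ℕ.∸ 1) σ)
    in E* σ' ≡ E* σ + (((ℤ.- ℤ.1ℤ) ℤ.^ n) ℚ./ 1) * recip ((qn ℤ.* (qn ℤ.- qn₁)) ℚ./ 1)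
lemma3p6 τ (suc (suc a)) 1≤τ (s≤s (s≤s z≤n)) = begin
  E* (τ ++ suc a ∷ 1 ∷ [])
    ≡⟨ E*-split-last τ (cf-[a,1]≡cf-[1+a] a) ⟩
  E* σ + (cf σ - cf (τ ∷ʳ suc a))
    ≡⟨ cong (λ d → E* σ + d) (cf-∷ʳ-difference τ a 1≤τ) ⟩
  E* σ + ((±1 / 1) * recip ((+ denom τ 1 (suc (suc a)) ℤ.* (+ denom τ 1 (suc (suc a)) ℤ.- + denom τ 0 1)) / 1))
    ≡⟨ cong₂ (λ q q₁ → E* σ + ((±1 / 1) * recip ((+ q ℤ.* (+ q ℤ.- + q₁)) / 1)))
             (q*-suc-length τ (suc a) 1≤τ) (q*-length τ (suc (suc a) ∷ []) 1≤τ) ⟨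
  E* σ + ((±1 / 1) * recip ((+ q* n σ ℤ.* (+ q* n σ ℤ.- + q* (length τ) σ)) / 1)) ∎
  where
  σ  = τ ∷ʳ suc (suc a)
  n  = suc (length τ)
  ±1 = -1ℤ ℤ.^ n
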